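{- Let $p$ be an odd prime and $N\in\mathbf{F}_p^\times$. Define $$\mathcal{S}(N)=\Big\{(u,a)\in \mathbf{F}_p^\times \times(\mathbf{F}_p^\times\setminus\{ 1\}):\ u \ne a,\ u\ne a^{ -1},\ (ua-1)^{ -1}(ua^{ -1}-1)(a-1)^2= N\Big\}$$ and $$\mathcal{S}^*(N)=\Big\{(u,a)\in \mathbf{F}_p^\times \times(\mathbf{F}_p^\times\setminus\{\pm1\}):\ (a-1)^2\ne N,\ (a^{ -1}-1)^2\ne N,\ u= \big((a-1)^2-N\big)\big((a-1)^2a^{ -1}-aN\big)^{ -1}\Big\}.$$ Then $\mathcal{S}(N)=\mathcal{S}^*(N)$ if $N\ne 4$, and $$\mathcal{S}(4)=\mathcal{S}^*(4)\cup \left\{(u,-1):u\in\mathbf{F}_p^\times\setminus\{ -1\}\right\}.$$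
   Context: All computations are in the field $\mathbf{F}_p$; $x^{ -1}$ denotes the multiplicative inverse of a nonzero $x$ (in $\mathcal{S}(N)$ the element $ua-1$ is nonzero because $u\neq a^{ -1}$). -}

module Defs where

open import Data.Nat using (ℕ; NonZero; _∸_) renaming (_+_ to _+ℕ_; _*_ to _*ℕ_)
open import Data.Nat.DivMod using (_mod_)
open import Data.Fin using (Fin; toℕ)
open import Data.Fin.Properties using (any?) renaming (_≟_ to _≟ᶠ_)
open import Data.Product using (_×_; _,_)
open import Relation.Nullary using (¬_; yes; no)
open import Relation.Binary.PropositionalEquality using (_≡_; _≢_)

module 𝔽 (p : ℕ) .{{_ : NonZero p}} where

  F : Set
  F = Fin p

  infixl 6 _+_ _-_
  infixl 7 _*_

  _+_ : F → F → F
  x + y = (toℕ x +ℕ toℕ y) mod p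

  _*_ : F → F → F
  x * y = (toℕ x *ℕ toℕ y) mod p

  _-_ : F → F → F
  x - y = (toℕ x +ℕ (p ∸ toℕ y)) mod p

  [_] : ℕ → F
  [ n ] = n mod p

  𝟘 𝟙 : F
  𝟘 = [ 0 ]
  𝟙 = [ 1 ]

  -_ : F → F
  - x = 𝟘 - x

  -- multiplicative inverse: the (unique, for p prime and x ≠ 0) y with x * y = 1;
  -- returns 0 when no such y exists (only relevant for x = 0).
  _⁻¹ : F → F
  x ⁻¹ with any? (λ y → x * y ≟ᶠ 𝟙)
  ... | yes (y , _) = y
  ... | no _ = 𝟘

  𝒮 : F → F → F → Set
  𝒮 N u a =
    u ≢ 𝟘 × a ≢ 𝟘 × a ≢ 𝟙 × u ≢ a × u ≢ a ⁻¹ ×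
    ((u * a - 𝟙) ⁻¹ * (u * a ⁻¹ - 𝟙) * ((a - 𝟙) * (a - 𝟙)) ≡ N)

  𝒮* : F → F → F → Set
  𝒮* N u a =
    u ≢ 𝟘 × a ≢ 𝟘 × a ≢ 𝟙 × a ≢ - 𝟙 ×
    (a - 𝟙) * (a - 𝟙) ≢ N × (a ⁻¹ - 𝟙) * (a ⁻¹ - 𝟙) ≢ N ×
    (u ≡ ((a - 𝟙) * (a - 𝟙) - N) * ((a - 𝟙) * (a - 𝟙) * a ⁻¹ - a * N) ⁻¹)

module Submission where

open import Defs
open import Data.Nat using (ℕ; NonZero)
open import Data.Nat.Primality using (Prime)
open import Data.Product using (_×_; _,_)
open import Data.Sum using (_⊎_)
open import Function.Bundles using (_⇔_)
open import Relation.Binary.PropositionalEquality using (_≡_; _≢_)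

import Data.Nat as ℕ
import Data.Nat.Properties as ℕ
open import Data.Nat.DivMod
  using (_%_; m%n<n; m<n⇒m%n≡m; %-distribˡ-+; %-distribˡ-*; n%n≡0; [m+kn]%n≡m%n; m*n%n≡0)
open import Data.Nat.Primality using (prime⇒nonTrivial)
open import Data.Nat.Coprimality using (prime⇒coprime; coprime-Bézout)
open import Data.Nat.GCD using (module Bézout)
open import Data.Integer as ℤ using (ℤ; -[1+_]; _⊖_)
import Data.Integer.Properties as ℤ
open import Data.Fin using (Fin; toℕ)
open import Data.Fin.Properties using (toℕ-fromℕ<; toℕ-injective; toℕ<n; any?; _≟_)
open import Data.Vec using (Vec; lookup)
open import Data.Product using (∃)
open import Data.Sum using (inj₁; inj₂) renaming (map to map-⊎; [_,_] to either)
open import Data.Maybe using () renaming (map to maybe-map)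
open import Data.Empty using (⊥-elim)
open import Function.Base using (id)
open import Function.Bundles using (mk⇔; Equivalence)
open import Relation.Nullary using (yes; no)
open import Relation.Nullary.Decidable using (dec⇒maybe)
open import Relation.Binary.PropositionalEquality
  using (refl; sym; trans; cong; cong₂; subst; isEquivalence; setoid; module ≡-Reasoning)
open import Algebra.Bundles using (CommutativeRing)
open import Algebra.Consequences.Propositional
  using (comm∧idˡ⇒id; comm∧invʳ⇒inv; comm∧distrʳ⇒distrˡ)
import Algebra.Solver.Ring
open import Algebra.Solver.Ring.AlmostCommutativeRing
  using (fromCommutativeRing; _-Raw-AlmostCommutative⟶_)

-- Write b = a⁻¹, q = (a-1)²,
-- r = (b-1)², D = qb - aN, w = ua - 1, s = ub - 1.  Everything rests on
-- the polynomial identity  s q - N w = u D - (q - N):  for w ≠ 0 the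
-- equation of 𝒮 is  s q = N w,  and for D ≠ 0 that of 𝒮* is  u D = q - N.
-- The side conditions match because D = a (r - N), and because u = a or
-- u = b would force a² = 1.  The only point not covered is a = -1, where
-- s = w and q = 4, so 𝒮 contains (u , -1) exactly when N = 4.

-- Arithmetic of F_p = Fin p: every residue is the image [ m ] of a
-- natural number, and [_] turns + and * on ℕ into + and * on F_p.  Hence
-- each ring law of F_p is inherited from the corresponding law of ℕ.
module Residues (p : ℕ) .{{_ : NonZero p}} where
  open 𝔽 p

  toℕ-[_] : ∀ m → toℕ [ m ] ≡ m % p
  toℕ-[ m ] = toℕ-fromℕ< (m%n<n m p)

  [_]-cong-mod : ∀ {m n} → m % p ≡ n % p → [ m ] ≡ [ n ]
  [_]-cong-mod {m} {n} eq = toℕ-injective (trans toℕ-[ m ] (trans eq (sym toℕ-[ n ])))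

  [toℕ] : ∀ x → [ toℕ x ] ≡ x
  [toℕ] x = toℕ-injective (trans toℕ-[ toℕ x ] (m<n⇒m%n≡m (toℕ<n x)))

  [_]-+ : ∀ m n → [ m ] + [ n ] ≡ [ m ℕ.+ n ]
  [_]-+ m n = [_]-cong-mod (trans (cong (_% p) (cong₂ ℕ._+_ toℕ-[ m ] toℕ-[ n ]))
                                  (sym (%-distribˡ-+ m n p)))

  [_]-* : ∀ m n → [ m ] * [ n ] ≡ [ m ℕ.* n ]
  [_]-* m n = [_]-cong-mod (trans (cong (_% p) (cong₂ ℕ._*_ toℕ-[ m ] toℕ-[ n ]))
                                  (sym (%-distribˡ-* m n p)))

  residue-ind : (P : F → Set) → (∀ m → P [ m ]) → ∀ x → P x
  residue-ind P P[_] x = subst P ([toℕ] x) P[ toℕ x ]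

  residue-ind₂ : (P : F → F → Set) → (∀ m n → P [ m ] [ n ]) → ∀ x y → P x y
  residue-ind₂ P P[_,_] x = residue-ind (P x) (λ n → residue-ind (λ x → P x [ n ]) (λ m → P[ m , n ]) x)

  residue-ind₃ : (P : F → F → F → Set) → (∀ m n k → P [ m ] [ n ] [ k ]) → ∀ x y z → P x y z
  residue-ind₃ P P[_,_,_] x y = residue-ind (P x y)
    (λ k → residue-ind₂ (λ x y → P x y [ k ]) (λ m n → P[ m , n , k ]) x y)

  open ≡-Reasoning

  +-assoc : ∀ x y z → (x + y) + z ≡ x + (y + z)
  +-assoc = residue-ind₃ _ λ m n k → begin
    ([ m ] + [ n ]) + [ k ]  ≡⟨ cong (_+ [ k ]) ([ m ]-+ n) ⟩
    [ m ℕ.+ n ] + [ k ]      ≡⟨ [ m ℕ.+ n ]-+ k ⟩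
    [ m ℕ.+ n ℕ.+ k ]        ≡⟨ cong [_] (ℕ.+-assoc m n k) ⟩
    [ m ℕ.+ (n ℕ.+ k) ]      ≡⟨ [ m ]-+ (n ℕ.+ k) ⟨
    [ m ] + [ n ℕ.+ k ]      ≡⟨ cong ([ m ] +_) ([ n ]-+ k) ⟨
    [ m ] + ([ n ] + [ k ])  ∎

  +-comm : ∀ x y → x + y ≡ y + x
  +-comm = residue-ind₂ _ λ m n → begin
    [ m ] + [ n ]  ≡⟨ [ m ]-+ n ⟩
    [ m ℕ.+ n ]    ≡⟨ cong [_] (ℕ.+-comm m n) ⟩
    [ n ℕ.+ m ]    ≡⟨ [ n ]-+ m ⟨
    [ n ] + [ m ]  ∎

  *-assoc : ∀ x y z → (x * y) * z ≡ x * (y * z)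
  *-assoc = residue-ind₃ _ λ m n k → begin
    ([ m ] * [ n ]) * [ k ]  ≡⟨ cong (_* [ k ]) ([ m ]-* n) ⟩
    [ m ℕ.* n ] * [ k ]      ≡⟨ [ m ℕ.* n ]-* k ⟩
    [ m ℕ.* n ℕ.* k ]        ≡⟨ cong [_] (ℕ.*-assoc m n k) ⟩
    [ m ℕ.* (n ℕ.* k) ]      ≡⟨ [ m ]-* (n ℕ.* k) ⟨
    [ m ] * [ n ℕ.* k ]      ≡⟨ cong ([ m ] *_) ([ n ]-* k) ⟨
    [ m ] * ([ n ] * [ k ])  ∎

  *-comm : ∀ x y → x * y ≡ y * x
  *-comm = residue-ind₂ _ λ m n → begin
    [ m ] * [ n ]  ≡⟨ [ m ]-* n ⟩
    [ m ℕ.* n ]    ≡⟨ cong [_] (ℕ.*-comm m n) ⟩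
    [ n ℕ.* m ]    ≡⟨ [ n ]-* m ⟨
    [ n ] * [ m ]  ∎

  +-identityˡ : ∀ x → 𝟘 + x ≡ x
  +-identityˡ = residue-ind _ λ m → [ 0 ]-+ m

  *-identityˡ : ∀ x → 𝟙 * x ≡ x
  *-identityˡ = residue-ind _ λ m → trans ([ 1 ]-* m) (cong [_] (ℕ.*-identityˡ m))

  *-distribʳ-+ : ∀ x y z → (y + z) * x ≡ y * x + z * x
  *-distribʳ-+ = residue-ind₃ _ λ k m n → begin
    ([ m ] + [ n ]) * [ k ]      ≡⟨ cong (_* [ k ]) ([ m ]-+ n) ⟩
    [ m ℕ.+ n ] * [ k ]          ≡⟨ [ m ℕ.+ n ]-* k ⟩
    [ (m ℕ.+ n) ℕ.* k ]          ≡⟨ cong [_] (ℕ.*-distribʳ-+ k m n) ⟩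
    [ m ℕ.* k ℕ.+ n ℕ.* k ]      ≡⟨ [ m ℕ.* k ]-+ (n ℕ.* k) ⟨
    [ m ℕ.* k ] + [ n ℕ.* k ]    ≡⟨ cong₂ _+_ ([ m ]-* k) ([ n ]-* k) ⟨
    [ m ] * [ k ] + [ n ] * [ k ] ∎

  0%p : 0 % p ≡ 0
  0%p = m<n⇒m%n≡m (ℕ.>-nonZero⁻¹ p)

  -‿as-residue : ∀ x → - x ≡ [ p ℕ.∸ toℕ x ]
  -‿as-residue x = cong (λ z → [ z ℕ.+ (p ℕ.∸ toℕ x) ]) (trans toℕ-[ 0 ] 0%p)

  -‿as-+ : ∀ x y → x - y ≡ x + - y
  -‿as-+ x y = sym (begin
    x + - y                         ≡⟨ cong₂ _+_ (sym ([toℕ] x)) (-‿as-residue y) ⟩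
    [ toℕ x ] + [ p ℕ.∸ toℕ y ]     ≡⟨ [ toℕ x ]-+ (p ℕ.∸ toℕ y) ⟩
    x - y                           ∎)

  +-inverseʳ : ∀ x → x + - x ≡ 𝟘
  +-inverseʳ x = begin
    x + - x                         ≡⟨ -‿as-+ x x ⟨
    [ toℕ x ℕ.+ (p ℕ.∸ toℕ x) ]     ≡⟨ cong [_] (ℕ.m+[n∸m]≡n (ℕ.<⇒≤ (toℕ<n x))) ⟩
    [ p ]                           ≡⟨ [_]-cong-mod (trans (n%n≡0 p) (sym 0%p)) ⟩
    𝟘                               ∎

  commutativeRing : CommutativeRing _ _
  commutativeRing = record
    { Carrier = F ; _≈_ = _≡_ ; _+_ = _+_ ; _*_ = _*_ ; -_ = λ x → - x ; 0# = 𝟘 ; 1# = 𝟙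
    ; isCommutativeRing = record
      { isRing = record
        { +-isAbelianGroup = record
          { isGroup = record
            { isMonoid = record
              { isSemigroup = record
                { isMagma = record { isEquivalence = isEquivalence ; ∙-cong = cong₂ _+_ }
                ; assoc = +-assoc }
              ; identity = comm∧idˡ⇒id +-comm +-identityˡ }
            ; inverse = comm∧invʳ⇒inv +-comm +-inverseʳ
            ; ⁻¹-cong = cong (λ x → - x) }
          ; comm = +-comm }
        ; *-cong = cong₂ _*_
        ; *-assoc = *-assoc
        ; *-identity = comm∧idˡ⇒id *-comm *-identityˡ
        ; distrib = comm∧distrʳ⇒distrˡ *-comm *-distribʳ-+ , *-distribʳ-+ }
      ; *-comm = *-comm } }

-- The canonical ring homomorphism ℤ → F_p.  It lets the ring solver of the
-- library, which normalises polynomials with integer coefficients, decide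
-- polynomial identities in F_p.
module IntegerImage (p : ℕ) .{{_ : NonZero p}} where
  open 𝔽 p
  open Residues p
  open import Algebra.Properties.Ring (CommutativeRing.ring commutativeRing)
    using (-0#≈0#; -‿involutive; -‿+-comm; -‿distribˡ-*; -‿distribʳ-*; //-rightDividesʳ; ⁻¹-anti-homo‿-)
  open ≡-Reasoning

  fromℤ : ℤ → F
  fromℤ (ℤ.+ n)    = [ n ]
  fromℤ -[1+ n ] = - [ ℕ.suc n ]

  fromℤ-neg : ∀ z → fromℤ (ℤ.- z) ≡ - fromℤ z
  fromℤ-neg (ℤ.+ ℕ.zero)   = sym -0#≈0#
  fromℤ-neg (ℤ.+ ℕ.suc n)  = refl
  fromℤ-neg -[1+ n ]     = sym (-‿involutive _)

  fromℤ-⊖-≥ : ∀ {m n} → n ℕ.≤ m → fromℤ (m ⊖ n) ≡ [ m ] + - [ n ]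
  fromℤ-⊖-≥ {m} {n} n≤m = begin
    fromℤ (m ⊖ n)                    ≡⟨ cong fromℤ (ℤ.⊖-≥ n≤m) ⟩
    [ m ℕ.∸ n ]                      ≡⟨ //-rightDividesʳ [ n ] [ m ℕ.∸ n ] ⟨
    [ m ℕ.∸ n ] + [ n ] + - [ n ]    ≡⟨ cong (_+ - [ n ]) ([ m ℕ.∸ n ]-+ n) ⟩
    [ m ℕ.∸ n ℕ.+ n ] + - [ n ]      ≡⟨ cong (λ k → [ k ] + - [ n ]) (ℕ.m∸n+n≡m n≤m) ⟩
    [ m ] + - [ n ]                  ∎

  fromℤ-⊖ : ∀ m n → fromℤ (m ⊖ n) ≡ [ m ] + - [ n ]
  fromℤ-⊖ m n with ℕ.≤-total n m
  ... | inj₁ n≤m = fromℤ-⊖-≥ n≤m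
  ... | inj₂ m≤n = begin
    fromℤ (m ⊖ n)         ≡⟨ cong fromℤ (ℤ.⊖-swap m n) ⟩
    fromℤ (ℤ.- (n ⊖ m))   ≡⟨ fromℤ-neg (n ⊖ m) ⟩
    - fromℤ (n ⊖ m)       ≡⟨ cong -_ (fromℤ-⊖-≥ m≤n) ⟩
    - ([ n ] + - [ m ])   ≡⟨ ⁻¹-anti-homo‿- [ n ] [ m ] ⟩
    [ m ] + - [ n ]       ∎

  fromℤ-+ : ∀ x y → fromℤ (x ℤ.+ y) ≡ fromℤ x + fromℤ y
  fromℤ-+ (ℤ.+ m)    (ℤ.+ n)    = sym ([ m ]-+ n)
  fromℤ-+ (ℤ.+ m)    -[1+ n ] = fromℤ-⊖ m (ℕ.suc n)
  fromℤ-+ -[1+ m ] (ℤ.+ n)    = trans (fromℤ-⊖ n (ℕ.suc m)) (+-comm [ n ] _)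
  fromℤ-+ -[1+ m ] -[1+ n ] = begin
    - [ ℕ.suc (ℕ.suc (m ℕ.+ n)) ]        ≡⟨ cong (λ k → - [ ℕ.suc k ]) (ℕ.+-suc m n) ⟨
    - [ ℕ.suc m ℕ.+ ℕ.suc n ]            ≡⟨ cong -_ ([ ℕ.suc m ]-+ (ℕ.suc n)) ⟨
    - ([ ℕ.suc m ] + [ ℕ.suc n ])        ≡⟨ -‿+-comm [ ℕ.suc m ] [ ℕ.suc n ] ⟨
    - [ ℕ.suc m ] + - [ ℕ.suc n ]        ∎

  fromℤ-*-+ : ∀ m y → fromℤ (ℤ.+ m ℤ.* y) ≡ [ m ] * fromℤ y
  fromℤ-*-+ m (ℤ.+ n)    = trans (cong fromℤ (sym (ℤ.pos-* m n))) (sym ([ m ]-* n))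
  fromℤ-*-+ m -[1+ n ] = begin
    fromℤ (ℤ.+ m ℤ.* -[1+ n ])             ≡⟨ cong fromℤ (ℤ.neg-distribʳ-* (ℤ.+ m) (ℤ.+ ℕ.suc n)) ⟨
    fromℤ (ℤ.- (ℤ.+ m ℤ.* ℤ.+ ℕ.suc n))      ≡⟨ fromℤ-neg (ℤ.+ m ℤ.* ℤ.+ ℕ.suc n) ⟩
    - fromℤ (ℤ.+ m ℤ.* ℤ.+ ℕ.suc n)          ≡⟨ cong -_ (fromℤ-*-+ m (ℤ.+ ℕ.suc n)) ⟩
    - ([ m ] * [ ℕ.suc n ])              ≡⟨ -‿distribʳ-* [ m ] [ ℕ.suc n ] ⟩
    [ m ] * - [ ℕ.suc n ]                ∎

  fromℤ-* : ∀ x y → fromℤ (x ℤ.* y) ≡ fromℤ x * fromℤ y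
  fromℤ-* (ℤ.+ m)    y = fromℤ-*-+ m y
  fromℤ-* -[1+ m ] y = begin
    fromℤ (-[1+ m ] ℤ.* y)               ≡⟨ cong fromℤ (ℤ.neg-distribˡ-* (ℤ.+ ℕ.suc m) y) ⟨
    fromℤ (ℤ.- (ℤ.+ ℕ.suc m ℤ.* y))        ≡⟨ fromℤ-neg (ℤ.+ ℕ.suc m ℤ.* y) ⟩
    - fromℤ (ℤ.+ ℕ.suc m ℤ.* y)            ≡⟨ cong -_ (fromℤ-*-+ (ℕ.suc m) y) ⟩
    - ([ ℕ.suc m ] * fromℤ y)            ≡⟨ -‿distribˡ-* [ ℕ.suc m ] (fromℤ y) ⟩
    - [ ℕ.suc m ] * fromℤ y              ∎

  fromℤ-homomorphism : ℤ.+-*-rawRing -Raw-AlmostCommutative⟶ fromCommutativeRing commutativeRing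
  fromℤ-homomorphism = record
    { ⟦_⟧ = fromℤ ; +-homo = fromℤ-+ ; *-homo = fromℤ-* ; -‿homo = fromℤ-neg
    ; 0-homo = refl ; 1-homo = refl }

  -- Polynomial expressions over F_p with integer constants; unlike the
  -- library's syntax they contain the subtraction _-_ of F_p itself, so
  -- that identities can be stated exactly as the definitions write them.
  infixl 6 _:+_ _:-_
  infixl 7 _:*_
  infix  8 :-_

  data Expr (n : ℕ) : Set where
    var        : Fin n → Expr n
    con        : ℤ → Expr n
    _:+_ _:-_ _:*_ : Expr n → Expr n → Expr n
    :-_        : Expr n → Expr n

  :1 : ∀ {n} → Expr n
  :1 = con (ℤ.+ 1)

  ⟦_⟧ : ∀ {n} → Expr n → Vec F n → F
  ⟦ var i  ⟧ ρ = lookup ρ i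
  ⟦ con c  ⟧ ρ = fromℤ c
  ⟦ e :+ f ⟧ ρ = ⟦ e ⟧ ρ + ⟦ f ⟧ ρ
  ⟦ e :- f ⟧ ρ = ⟦ e ⟧ ρ - ⟦ f ⟧ ρ
  ⟦ e :* f ⟧ ρ = ⟦ e ⟧ ρ * ⟦ f ⟧ ρ
  ⟦ :- e   ⟧ ρ = - ⟦ e ⟧ ρ

  module Horner = Algebra.Solver.Ring ℤ.+-*-rawRing (fromCommutativeRing commutativeRing)
    fromℤ-homomorphism (λ x y → maybe-map (cong fromℤ) (dec⇒maybe (x ℤ.≟ y)))

  toPolynomial : ∀ {n} → Expr n → Horner.Polynomial n
  toPolynomial (var i)  = Horner.var i
  toPolynomial (con c)  = Horner.con c
  toPolynomial (e :+ f) = toPolynomial e Horner.:+ toPolynomial f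
  toPolynomial (e :- f) = toPolynomial e Horner.:- toPolynomial f
  toPolynomial (e :* f) = toPolynomial e Horner.:* toPolynomial f
  toPolynomial (:- e)   = Horner.:- toPolynomial e

  toPolynomial-correct : ∀ {n} (e : Expr n) ρ → Horner.⟦ toPolynomial e ⟧ ρ ≡ ⟦ e ⟧ ρ
  toPolynomial-correct (var i)  ρ = refl
  toPolynomial-correct (con c)  ρ = refl
  toPolynomial-correct (e :+ f) ρ = cong₂ _+_ (toPolynomial-correct e ρ) (toPolynomial-correct f ρ)
  toPolynomial-correct (e :- f) ρ =
    trans (cong₂ (λ x y → x + - y) (toPolynomial-correct e ρ) (toPolynomial-correct f ρ))
          (sym (-‿as-+ (⟦ e ⟧ ρ) (⟦ f ⟧ ρ)))
  toPolynomial-correct (e :* f) ρ = cong₂ _*_ (toPolynomial-correct e ρ) (toPolynomial-correct f ρ)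
  toPolynomial-correct (:- e)   ρ = cong -_ (toPolynomial-correct e ρ)

  ⟦_⇓⟧ : ∀ {n} → Expr n → Vec F n → F
  ⟦ e ⇓⟧ = Horner.⟦ toPolynomial e ⟧↓

  normal-form-correct : ∀ {n} (e : Expr n) ρ → ⟦ e ⇓⟧ ρ ≡ ⟦ e ⟧ ρ
  normal-form-correct e ρ = trans (Horner.correct (toPolynomial e) ρ) (toPolynomial-correct e ρ)

  open import Relation.Binary.Reflection (setoid F) var ⟦_⟧ ⟦_⇓⟧ normal-form-correct
    public using (solve; _⊜_)


module RingLemmas (p : ℕ) .{{_ : NonZero p}} where
  open 𝔽 p
  open Residues p using (commutativeRing)
  open IntegerImage p
  open CommutativeRing commutativeRing using (*-identityˡ; *-identityʳ)
  open ≡-Reasoning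

  x-y≡0⇒x≡y : ∀ {x y} → x - y ≡ 𝟘 → x ≡ y
  x-y≡0⇒x≡y {x} {y} x-y≡0 = begin
    x              ≡⟨ solve 2 (λ x y → x ⊜ (x :- y) :+ y) refl x y ⟩
    (x - y) + y    ≡⟨ cong (_+ y) x-y≡0 ⟩
    𝟘 + y          ≡⟨ solve 1 (λ y → con (ℤ.+ 0) :+ y ⊜ y) refl y ⟩
    y              ∎

  x≡y⇒x-y≡0 : ∀ {x y} → x ≡ y → x - y ≡ 𝟘
  x≡y⇒x-y≡0 {x} refl = solve 1 (λ x → x :- x ⊜ con (ℤ.+ 0)) refl x

  same-difference : ∀ {x y x′ y′} → x - y ≡ x′ - y′ → x ≡ y → x′ ≡ y′
  same-difference eq x≡y = x-y≡0⇒x≡y (trans (sym eq) (x≡y⇒x-y≡0 x≡y))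

  inverse-unique : ∀ {x y z} → x * y ≡ 𝟙 → x * z ≡ 𝟙 → y ≡ z
  inverse-unique {x} {y} {z} xy≡1 xz≡1 = begin
    y              ≡⟨ *-identityʳ y ⟨
    y * 𝟙          ≡⟨ cong (y *_) xz≡1 ⟨
    y * (x * z)    ≡⟨ solve 3 (λ x y z → y :* (x :* z) ⊜ (x :* y) :* z) refl x y z ⟩
    (x * y) * z    ≡⟨ cong (_* z) xy≡1 ⟩
    𝟙 * z          ≡⟨ *-identityˡ z ⟩
    z              ∎

  linear-iff : ∀ {d e u c} → d * e ≡ 𝟙 → (u ≡ c * e ⇔ u * d ≡ c)
  linear-iff {d} {e} {u} {c} de≡1 = mk⇔
    (λ u≡ce → begin
      u * d          ≡⟨ cong (_* d) u≡ce ⟩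
      c * e * d      ≡⟨ solve 3 (λ c d e → c :* e :* d ⊜ c :* (d :* e)) refl c d e ⟩
      c * (d * e)    ≡⟨ cong (c *_) de≡1 ⟩
      c * 𝟙          ≡⟨ *-identityʳ c ⟩
      c              ∎)
    (λ ud≡c → begin
      u              ≡⟨ *-identityʳ u ⟨
      u * 𝟙          ≡⟨ cong (u *_) de≡1 ⟨
      u * (d * e)    ≡⟨ solve 3 (λ u d e → u :* (d :* e) ⊜ u :* d :* e) refl u d e ⟩
      u * d * e      ≡⟨ cong (_* e) ud≡c ⟩
      c * e          ∎)

-- For p prime, F_p is a field: a residue x ≠ 0 has toℕ x coprime to p,
-- and a Bézout identity for (p , toℕ x) exhibits an inverse.
module Field (p : ℕ) .{{_ : NonZero p}} (p-prime : Prime p) where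
  open 𝔽 p
  open Residues p
  open IntegerImage p
  open RingLemmas p
  open CommutativeRing commutativeRing using (zeroˡ)
  open import Algebra.Properties.Ring (CommutativeRing.ring commutativeRing)
    using (-‿involutive; -‿distribʳ-*; +-inverseʳ-unique)
  open ≡-Reasoning

  inverse-exists : ∀ x → x ≢ 𝟘 → ∃ λ y → x * y ≡ 𝟙
  inverse-exists x x≢0 = from-Bézout (coprime-Bézout (prime⇒coprime p-prime (toℕ<n x)))
    where
    instance
      toℕx≢0 : NonZero (toℕ x)
      toℕx≢0 = ℕ.≢-nonZero (λ eq → x≢0 (trans (sym ([toℕ] x)) (cong [_] eq)))

    x*[_] : ∀ b → x * [ b ] ≡ [ b ℕ.* toℕ x ]
    x*[ b ] = begin
      x * [ b ]              ≡⟨ cong (_* [ b ]) ([toℕ] x) ⟨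
      [ toℕ x ] * [ b ]      ≡⟨ [ toℕ x ]-* b ⟩
      [ toℕ x ℕ.* b ]        ≡⟨ cong [_] (ℕ.*-comm (toℕ x) b) ⟩
      [ b ℕ.* toℕ x ]        ∎

    from-Bézout : Bézout.Identity 1 p (toℕ x) → ∃ λ y → x * y ≡ 𝟙
    from-Bézout (Bézout.-+ a b eq) = [ b ] , (begin
      x * [ b ]              ≡⟨ x*[ b ] ⟩
      [ b ℕ.* toℕ x ]        ≡⟨ cong [_] eq ⟨
      [ 1 ℕ.+ a ℕ.* p ]      ≡⟨ [_]-cong-mod ([m+kn]%n≡m%n 1 a p) ⟩
      𝟙                      ∎)
    from-Bézout (Bézout.+- a b eq) = - [ b ] , (begin
      x * - [ b ]            ≡⟨ -‿distribʳ-* x [ b ] ⟨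
      - (x * [ b ])          ≡⟨ cong -_ (+-inverseʳ-unique 𝟙 (x * [ b ]) 𝟙+x[b]≡0) ⟩
      - - 𝟙                  ≡⟨ -‿involutive 𝟙 ⟩
      𝟙                      ∎)
      where
      𝟙+x[b]≡0 : 𝟙 + x * [ b ] ≡ 𝟘
      𝟙+x[b]≡0 = begin
        𝟙 + x * [ b ]        ≡⟨ cong (𝟙 +_) x*[ b ] ⟩
        𝟙 + [ b ℕ.* toℕ x ]  ≡⟨ [ 1 ]-+ (b ℕ.* toℕ x) ⟩
        [ 1 ℕ.+ b ℕ.* toℕ x ] ≡⟨ cong [_] eq ⟩
        [ a ℕ.* p ]          ≡⟨ [_]-cong-mod (trans (m*n%n≡0 a p) (sym 0%p)) ⟩
        𝟘                    ∎

  -- _⁻¹ searches for an inverse, so it finds one whenever one exists.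
  *-inverseʳ : ∀ x → x ≢ 𝟘 → x * x ⁻¹ ≡ 𝟙
  *-inverseʳ x x≢0 with any? (λ y → x * y ≟ 𝟙)
  ... | yes (_ , xy≡1) = xy≡1
  ... | no ∄y          = ⊥-elim (∄y (inverse-exists x x≢0))

  cancel-inverse : ∀ {x y z c} → x ≢ 𝟘 → (x ⁻¹ * y * z ≡ c ⇔ y * z ≡ c * x)
  cancel-inverse {x} {y} {z} {c} x≢0 = mk⇔
    (λ eq → Equivalence.from equation (trans (reorder x (x ⁻¹) y z) eq))
    (λ eq → trans (sym (reorder x (x ⁻¹) y z)) (Equivalence.to equation eq))
    where
    equation : y * z ≡ c * x ⇔ y * z * x ⁻¹ ≡ c
    equation = linear-iff (trans (*-comm (x ⁻¹) x) (*-inverseʳ x x≢0))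
    reorder : ∀ x i y z → y * z * i ≡ i * y * z
    reorder = solve 4 (λ x i y z → y :* z :* i ⊜ i :* y :* z) refl

  zero-product : ∀ {x y} → x * y ≡ 𝟘 → x ≡ 𝟘 ⊎ y ≡ 𝟘
  zero-product {x} {y} xy≡0 with x ≟ 𝟘
  ... | yes x≡0 = inj₁ x≡0
  ... | no  x≢0 = inj₂ (trans (Equivalence.from (linear-iff (*-inverseʳ x x≢0)) yx≡0) (zeroˡ _))
    where
    yx≡0 : y * x ≡ 𝟘
    yx≡0 = trans (*-comm y x) xy≡0

  nonzero-product : ∀ {x y} → x ≢ 𝟘 → y ≢ 𝟘 → x * y ≢ 𝟘
  nonzero-product x≢0 y≢0 xy≡0 = either x≢0 y≢0 (zero-product xy≡0)

  square-root-of-one : ∀ {x} → x * x ≡ 𝟙 → x ≡ 𝟙 ⊎ x ≡ - 𝟙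
  square-root-of-one {x} xx≡1 = map-⊎ x-y≡0⇒x≡y x-y≡0⇒x≡y (zero-product (begin
    (x - 𝟙) * (x - - 𝟙)  ≡⟨ solve 1 (λ x → (x :- :1) :* (x :- :- :1) ⊜ x :* x :- :1) refl x ⟩
    x * x - 𝟙            ≡⟨ x≡y⇒x-y≡0 xx≡1 ⟩
    𝟘                    ∎))

  [_]≢0 : ∀ m → 0 ℕ.< m → m ℕ.< p → [ m ] ≢ 𝟘
  [ m ]≢0 0<m m<p [m]≡0 = ℕ.<⇒≢ 0<m (sym (begin
    m             ≡⟨ m<n⇒m%n≡m m<p ⟨
    m % p         ≡⟨ toℕ-[ m ] ⟨
    toℕ [ m ]     ≡⟨ cong toℕ [m]≡0 ⟩
    toℕ 𝟘         ≡⟨ toℕ-[ 0 ] ⟩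
    0 % p         ≡⟨ 0%p ⟩
    0             ∎))

  1<p : 1 ℕ.< p
  1<p = ℕ.nonTrivial⇒n>1 p {{prime⇒nonTrivial p-prime}}

  𝟙≢𝟘 : 𝟙 ≢ 𝟘
  𝟙≢𝟘 = [ 1 ]≢0 (ℕ.s≤s ℕ.z≤n) 1<p

  -𝟙≢𝟘 : - 𝟙 ≢ 𝟘
  -𝟙≢𝟘 -1≡0 = 𝟙≢𝟘 (begin
    𝟙        ≡⟨ solve 0 (:1 ⊜ :- :- :1) refl ⟩
    - - 𝟙    ≡⟨ cong -_ -1≡0 ⟩
    - 𝟘      ≡⟨ solve 0 (:- con (ℤ.+ 0) ⊜ con (ℤ.+ 0)) refl ⟩
    𝟘        ∎)

  -𝟙≢𝟙 : p ≢ 2 → - 𝟙 ≢ 𝟙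
  -𝟙≢𝟙 p≢2 -1≡1 = [ 2 ]≢0 (ℕ.s≤s ℕ.z≤n) (ℕ.≤∧≢⇒< 1<p (λ 2≡p → p≢2 (sym 2≡p))) (begin
    [ 2 ]     ≡⟨ solve 0 (con (ℤ.+ 2) ⊜ :1 :- :- :1) refl ⟩
    𝟙 - - 𝟙   ≡⟨ cong (λ x → 𝟙 - x) -1≡1 ⟩
    𝟙 - 𝟙     ≡⟨ x≡y⇒x-y≡0 {𝟙} refl ⟩
    𝟘         ∎)

module Pairs (p : ℕ) .{{_ : NonZero p}} (p-prime : Prime p) where
  open 𝔽 p
  open Residues p using (commutativeRing; *-comm)
  open IntegerImage p
  open RingLemmas p
  open Field p p-prime
  open CommutativeRing commutativeRing using (*-identityˡ; zeroˡ; zeroʳ)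
  open ≡-Reasoning

  module Configuration (N u a b : F) (ab≡1 : a * b ≡ 𝟙) where
    q r D w s : F
    q = (a - 𝟙) * (a - 𝟙)
    r = (b - 𝟙) * (b - 𝟙)
    D = q * b - a * N
    w = u * a - 𝟙
    s = u * b - 𝟙

    -- The central identity  s q - N w = u D - (q - N): clearing the
    -- denominator in 𝒮 gives exactly the linear equation of 𝒮*.
    cleared⇔linear : s * q ≡ N * w ⇔ u * D ≡ q - N
    cleared⇔linear = mk⇔ (same-difference identity) (same-difference (sym identity))
      where
      identity : s * q - N * w ≡ u * D - (q - N)
      identity = solve 4 (λ u a b N →
          (u :* b :- :1) :* ((a :- :1) :* (a :- :1)) :- N :* (u :* a :- :1)
        ⊜ u :* ((a :- :1) :* (a :- :1) :* b :- a :* N) :- ((a :- :1) :* (a :- :1) :- N))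
        refl u a b N

    -- D = a (r - N), using b = a⁻¹; so D ≠ 0 exactly when r ≠ N.
    D≡a[r-N] : D ≡ a * (r - N)
    D≡a[r-N] = sym (begin
      a * (r - N)                           ≡⟨ cong (λ t → a * ((b - t) * (b - t) - N)) ab≡1 ⟨
      a * ((b - a * b) * (b - a * b) - N)   ≡⟨ solve 3 (λ a b N →
                                                 a :* ((b :- a :* b) :* (b :- a :* b) :- N)
                                               ⊜ a :* b :* ((a :- :1) :* (a :- :1) :* b) :- a :* N)
                                               refl a b N ⟩
      a * b * (q * b) - a * N               ≡⟨ cong (λ t → t * (q * b) - a * N) ab≡1 ⟩
      𝟙 * (q * b) - a * N                   ≡⟨ cong (_- a * N) (*-identityˡ (q * b)) ⟩
      D                                     ∎)

    a≡b⇒a²≡1 : a ≡ b → a * a ≡ 𝟙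
    a≡b⇒a²≡1 a≡b = trans (cong (a *_) a≡b) ab≡1

    w≡0⇒u≡b : w ≡ 𝟘 → u ≡ b
    w≡0⇒u≡b w≡0 = inverse-unique {a} (trans (*-comm a u) (x-y≡0⇒x≡y w≡0)) ab≡1

    q≢0 : a ≢ 𝟙 → q ≢ 𝟘
    q≢0 a≢1 = nonzero-product (λ a-1≡0 → a≢1 (x-y≡0⇒x≡y a-1≡0)) (λ a-1≡0 → a≢1 (x-y≡0⇒x≡y a-1≡0))

    -- If D = 0 and q = N then D = q (b - a), forcing b = a, i.e. a² = 1.
    D≡0⇒q≢N : a ≢ 𝟙 → a * a ≢ 𝟙 → D ≡ 𝟘 → q ≢ N
    D≡0⇒q≢N a≢1 a²≢1 D≡0 q≡N =
      either (q≢0 a≢1) (λ b-a≡0 → a²≢1 (a≡b⇒a²≡1 (sym (x-y≡0⇒x≡y b-a≡0)))) (zero-product (begin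
        q * (b - a)      ≡⟨ solve 3 (λ q a b → q :* (b :- a) ⊜ q :* b :- a :* q) refl q a b ⟩
        q * b - a * q    ≡⟨ cong (λ t → q * b - a * t) q≡N ⟩
        D                ≡⟨ D≡0 ⟩
        𝟘                ∎))

    -- Under the cleared equation, u = a would give N (a² - 1) = 0 ...
    cleared⇒u≢a : N ≢ 𝟘 → a * a ≢ 𝟙 → s * q ≡ N * w → u ≢ a
    cleared⇒u≢a N≢0 a²≢1 cleared u≡a =
      either N≢0 (λ a²-1≡0 → a²≢1 (x-y≡0⇒x≡y a²-1≡0)) (zero-product (begin
        N * (a * a - 𝟙)  ≡⟨ cong (λ t → N * (t * a - 𝟙)) u≡a ⟨
        N * w            ≡⟨ cleared ⟨
        s * q            ≡⟨ cong (λ t → (t * b - 𝟙) * q) u≡a ⟩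
        (a * b - 𝟙) * q  ≡⟨ cong (_* q) (x≡y⇒x-y≡0 ab≡1) ⟩
        𝟘 * q            ≡⟨ zeroˡ q ⟩
        𝟘                ∎))

    -- ... and u = b would give (b² - 1) q = 0, i.e. b² = 1, so a² = 1.
    cleared⇒u≢b : a ≢ 𝟙 → a * a ≢ 𝟙 → s * q ≡ N * w → u ≢ b
    cleared⇒u≢b a≢1 a²≢1 cleared u≡b =
      either b²≢1 (q≢0 a≢1) (zero-product (begin
        (b * b - 𝟙) * q  ≡⟨ cong (λ t → (t * b - 𝟙) * q) u≡b ⟨
        s * q            ≡⟨ cleared ⟩
        N * w            ≡⟨ cong (λ t → N * (t * a - 𝟙)) u≡b ⟩
        N * (b * a - 𝟙)  ≡⟨ cong (λ t → N * t) (x≡y⇒x-y≡0 (trans (*-comm b a) ab≡1)) ⟩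
        N * 𝟘            ≡⟨ zeroʳ N ⟩
        𝟘                ∎))
      where
      b²≢1 : b * b - 𝟙 ≢ 𝟘
      b²≢1 b²-1≡0 = a²≢1 (a≡b⇒a²≡1 (inverse-unique {b} (trans (*-comm b a) ab≡1) (x-y≡0⇒x≡y b²-1≡0)))

  a²≢1 : ∀ {a} → a ≢ 𝟙 → a ≢ - 𝟙 → a * a ≢ 𝟙
  a²≢1 a≢1 a≢-1 a²≡1 = either a≢1 a≢-1 (square-root-of-one a²≡1)

  𝒮⇒𝒮* : ∀ {N u a} → N ≢ 𝟘 → a ≢ - 𝟙 → 𝒮 N u a → 𝒮* N u a
  𝒮⇒𝒮* {N} {u} {a} N≢0 a≢-1 (u≢0 , a≢0 , a≢1 , _ , u≢b , equation) =
    u≢0 , a≢0 , a≢1 , a≢-1 , q≢N , r≢N , Equivalence.from (linear-iff (*-inverseʳ D D≢0)) uD≡q-N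
    where
    open Configuration N u a (a ⁻¹) (*-inverseʳ a a≢0)
    uD≡q-N : u * D ≡ q - N
    uD≡q-N = Equivalence.to cleared⇔linear
      (Equivalence.to (cancel-inverse (λ w≡0 → u≢b (w≡0⇒u≡b w≡0))) equation)
    D≢0 : D ≢ 𝟘
    D≢0 D≡0 = D≡0⇒q≢N a≢1 (a²≢1 a≢1 a≢-1) D≡0 (x-y≡0⇒x≡y (begin
      q - N     ≡⟨ uD≡q-N ⟨
      u * D     ≡⟨ cong (u *_) D≡0 ⟩
      u * 𝟘     ≡⟨ zeroʳ u ⟩
      𝟘         ∎))
    q≢N : q ≢ N
    q≢N q≡N = nonzero-product u≢0 D≢0 (trans uD≡q-N (x≡y⇒x-y≡0 q≡N))
    r≢N : r ≢ N
    r≢N r≡N = D≢0 (begin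
      D             ≡⟨ D≡a[r-N] ⟩
      a * (r - N)   ≡⟨ cong (a *_) (x≡y⇒x-y≡0 r≡N) ⟩
      a * 𝟘         ≡⟨ zeroʳ a ⟩
      𝟘             ∎)

  𝒮*⇒𝒮 : ∀ {N u a} → N ≢ 𝟘 → 𝒮* N u a → 𝒮 N u a
  𝒮*⇒𝒮 {N} {u} {a} N≢0 (u≢0 , a≢0 , a≢1 , a≢-1 , q≢N , r≢N , u≡[q-N]D⁻¹) =
    u≢0 , a≢0 , a≢1 , cleared⇒u≢a N≢0 (a²≢1 a≢1 a≢-1) cleared , u≢b ,
    Equivalence.from (cancel-inverse (λ w≡0 → u≢b (w≡0⇒u≡b w≡0))) cleared
    where
    open Configuration N u a (a ⁻¹) (*-inverseʳ a a≢0)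
    D≢0 : D ≢ 𝟘
    D≢0 D≡0 = nonzero-product a≢0 (λ r-N≡0 → r≢N (x-y≡0⇒x≡y r-N≡0)) (trans (sym D≡a[r-N]) D≡0)
    cleared : s * q ≡ N * w
    cleared = Equivalence.from cleared⇔linear
      (Equivalence.to (linear-iff (*-inverseʳ D D≢0)) u≡[q-N]D⁻¹)
    u≢b : u ≢ a ⁻¹
    u≢b = cleared⇒u≢b a≢1 (a²≢1 a≢1 a≢-1) cleared

  -1⁻¹≡-1 : (- 𝟙) ⁻¹ ≡ - 𝟙
  -1⁻¹≡-1 = inverse-unique { - 𝟙} (*-inverseʳ (- 𝟙) -𝟙≢𝟘) (solve 0 (:- :1 :* :- :1 ⊜ :1) refl)

  -- At a = -1 one has s = w and q = 4, so the equation of 𝒮 reads N = 4.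
  𝒮-at-minus-one : p ≢ 2 → ∀ {N u} → 𝒮 N u (- 𝟙) ⇔ (N ≡ [ 4 ] × u ≢ 𝟘 × u ≢ - 𝟙)
  𝒮-at-minus-one p≢2 {N} {u} = mk⇔
    (λ { (u≢0 , _ , _ , u≢-1 , u≢b , equation) →
           trans (sym equation) (equation-at-minus-one u≢b) , u≢0 , u≢-1 })
    (λ { (N≡4 , u≢0 , u≢-1) →
           u≢0 , -𝟙≢𝟘 , -𝟙≢𝟙 p≢2 , u≢-1 , (λ u≡b → u≢-1 (trans u≡b -1⁻¹≡-1)) ,
           trans (equation-at-minus-one (λ u≡b → u≢-1 (trans u≡b -1⁻¹≡-1))) (sym N≡4) })
    where
    open Configuration N u (- 𝟙) ((- 𝟙) ⁻¹) (*-inverseʳ (- 𝟙) -𝟙≢𝟘)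
    equation-at-minus-one : u ≢ (- 𝟙) ⁻¹ → w ⁻¹ * s * q ≡ [ 4 ]
    equation-at-minus-one u≢b = begin
      w ⁻¹ * s * q   ≡⟨ cong (λ t → w ⁻¹ * (u * t - 𝟙) * q) -1⁻¹≡-1 ⟩
      w ⁻¹ * w * q   ≡⟨ Equivalence.from (cancel-inverse (λ w≡0 → u≢b (w≡0⇒u≡b w≡0))) (*-comm w q) ⟩
      q              ≡⟨ solve 0 ((:- :1 :- :1) :* (:- :1 :- :1) ⊜ con (ℤ.+ 4)) refl ⟩
      [ 4 ]          ∎

  𝒮-decomposition : p ≢ 2 → ∀ {N} → N ≢ 𝟘 → ∀ u a →
    𝒮 N u a ⇔ (𝒮* N u a ⊎ (a ≡ - 𝟙 × N ≡ [ 4 ] × u ≢ 𝟘 × u ≢ - 𝟙))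
  𝒮-decomposition p≢2 N≢0 u a with a ≟ - 𝟙
  ... | yes refl = mk⇔
    (λ in𝒮 → inj₂ (refl , Equivalence.to (𝒮-at-minus-one p≢2) in𝒮))
    (either (λ { (_ , _ , _ , a≢-1 , _) → ⊥-elim (a≢-1 refl) })
            (λ { (_ , rest) → Equivalence.from (𝒮-at-minus-one p≢2) rest }))
  ... | no a≢-1 = mk⇔
    (λ in𝒮 → inj₁ (𝒮⇒𝒮* N≢0 a≢-1 in𝒮))
    (either (𝒮*⇒𝒮 N≢0) (λ { (a≡-1 , _) → ⊥-elim (a≢-1 a≡-1) }))

lemma3p1 : (p : ℕ) .{{_ : NonZero p}} → Prime p → p ≢ 2 →
    let open 𝔽 p in
    (N : F) → N ≢ 𝟘 →
      (N ≢ [ 4 ] → ∀ u a → 𝒮 N u a ⇔ 𝒮* N u a)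
      × (N ≡ [ 4 ] → ∀ u a → 𝒮 N u a ⇔ (𝒮* N u a ⊎ (a ≡ - 𝟙 × u ≢ 𝟘 × u ≢ - 𝟙)))
lemma3p1 p p-prime p≢2 N N≢0 =
  (λ N≢4 u a → let module D = Equivalence (decomposition u a) in mk⇔
     (λ in𝒮 → either id (λ { (_ , N≡4 , _) → ⊥-elim (N≢4 N≡4) }) (D.to in𝒮))
     (λ in𝒮* → D.from (inj₁ in𝒮*))) ,
  (λ N≡4 u a → let module D = Equivalence (decomposition u a) in mk⇔
     (λ in𝒮 → map-⊎ id (λ { (a≡-1 , _ , rest) → a≡-1 , rest }) (D.to in𝒮))
     (λ in𝒮∪ → D.from (map-⊎ id (λ { (a≡-1 , rest) → a≡-1 , N≡4 , rest }) in𝒮∪)))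
  where
  open 𝔽 p
  decomposition : ∀ u a → 𝒮 N u a ⇔ (𝒮* N u a ⊎ (a ≡ - 𝟙 × N ≡ [ 4 ] × u ≢ 𝟘 × u ≢ - 𝟙))
  decomposition = Pairs.𝒮-decomposition p p-prime p≢2 N≢0
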